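{- Let $(X,*)$ be a finite quandle and let $1\in X$. Suppose that the cycles of the right translation $R_1$ (in its disjoint cycle decomposition, fixed points counted as cycles of length $1$) have pairwise distinct lengths, and that for every $i\in X$ the right translation $R_i$ has exactly one fixed point. Then the left translation $L_1$ is a permutation of $X$, and the elements of every cycle of $L_1$ are contained in some cycle of $R_1$.
   Context: A quandle is a set $X$ with a binary operation $*$ such that for all $i,j,k\in X$: (i) $i*i=i$; (ii) there exists a unique $x\in X$ with $x*j=i$; (iii) $(i*j)*k=(i*k)*(j*k)$. For $i\in X$, the right translation is $R_i:X\to X$, $j\mapsto j*i$ (a permutation of $X$), and the left translation is $L_i:X\to X$, $j\mapsto i*j$. -}

module Defs where

open import Data.Nat using (ℕ; zero; suc; _<_)
open import Data.Fin using (Fin)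
open import Data.Product using (Σ; ∃; _×_)
open import Function using (_∘_)
open import Relation.Binary.PropositionalEquality using (_≡_; _≢_)
open import Relation.Nullary using (¬_)

iter : {A : Set} → (A → A) → ℕ → A → A
iter f zero    x = x
iter f (suc k) x = f (iter f k x)

record IsQuandle {n : ℕ} (_∙_ : Fin n → Fin n → Fin n) : Set where
  field
    idem    : ∀ i → i ∙ i ≡ i
    rdiv    : ∀ i j → ∃ λ x → (x ∙ j ≡ i) × (∀ y → y ∙ j ≡ i → y ≡ x)
    rdistr  : ∀ i j k → (i ∙ j) ∙ k ≡ (i ∙ k) ∙ (j ∙ k)

R : {n : ℕ} → (Fin n → Fin n → Fin n) → Fin n → Fin n → Fin n
R _∙_ i j = j ∙ i

L : {n : ℕ} → (Fin n → Fin n → Fin n) → Fin n → Fin n → Fin n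
L _∙_ i j = i ∙ j

-- y lies in the cycle of f containing x (for a permutation f of a finite set)
SameCycle : {A : Set} → (A → A) → A → A → Set
SameCycle f x y = ∃ λ m → iter f m x ≡ y

CycleLength : {A : Set} → (A → A) → A → ℕ → Set
CycleLength f x k = (0 < k) × (iter f k x ≡ x) × (∀ j → 0 < j → j < k → iter f j x ≢ x)

DistinctCycleLengths : {A : Set} → (A → A) → Set
DistinctCycleLengths f = ∀ x y k → CycleLength f x k → CycleLength f y k → SameCycle f x y

UniqueFixedPoint : {A : Set} → (A → A) → Set
UniqueFixedPoint f = ∃ λ x → (f x ≡ x) × (∀ y → f y ≡ y → y ≡ x)

-- Write T = R₁. Right distributivity makes T an automorphism commuting with L₁, so L₁
-- maps T-cycles onto T-cycles. The key step: if 1 * a = 1 * b, then σ = R_b⁻¹ ∘ R_a is an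
-- injection commuting with T, so it preserves cycle lengths and, lengths being distinct,
-- maps a into its own T-cycle; the unique fixed points of the R_i then force every period
-- of a to be a period of b. Now induct on the length of the T-cycle of x: if 1 * x lay in
-- a shorter cycle C, then by induction L₁ permutes C, so 1 * x = 1 * y for some y ∈ C, and
-- x would inherit the shorter period of y. Hence L₁ keeps every element in its T-cycle and
-- acts on each cycle as a power of T, which gives both bijectivity and the claim on cycles.
module Submission where

open import Defs
open import Data.Nat using (ℕ; zero; suc; _+_; _*_; _≤_; _<_; z<s)
open import Data.Nat.Properties
  using (+-comm; +-suc; *-comm; m≤n⇒∃[o]m+o≡n; m≤n⇒m<n∨m≡n; ≮⇒≥; n<1+n; _<?_; anyUpTo?)
open import Data.Nat.Induction using (<-wellFounded)
open import Data.Fin using (Fin; toℕ; _≟_)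
open import Data.Fin.Properties using (pigeonhole)
open import Data.Product using (∃; _×_; _,_; proj₁; proj₂; map₂)
open import Data.Sum using (inj₁; inj₂)
open import Data.Empty using (⊥-elim)
open import Function.Definitions using (Injective; Bijective)
open import Function.Consequences.Propositional using (strictlySurjective⇒surjective)
open import Induction.WellFounded using (Acc; acc)
open import Relation.Binary.Definitions using (DecidableEquality)
open import Relation.Binary.PropositionalEquality
  using (_≡_; refl; sym; trans; cong; cong₂; subst; module ≡-Reasoning)
open import Relation.Nullary using (yes; no)
open import Relation.Nullary.Decidable using (_×-dec_)

open ≡-Reasoning

Periodic : {A : Set} → (A → A) → A → Set
Periodic f x = ∃ λ d → iter f (suc d) x ≡ x

module _ {A : Set} (f : A → A) where

  iter-+ : ∀ m k x → iter f (m + k) x ≡ iter f m (iter f k x)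
  iter-+ zero    k x = refl
  iter-+ (suc m) k x = cong f (iter-+ m k x)

  iter-comm : ∀ m k x → iter f m (iter f k x) ≡ iter f k (iter f m x)
  iter-comm m k x = begin
    iter f m (iter f k x) ≡⟨ iter-+ m k x ⟨
    iter f (m + k) x      ≡⟨ cong (λ l → iter f l x) (+-comm m k) ⟩
    iter f (k + m) x      ≡⟨ iter-+ k m x ⟩
    iter f k (iter f m x) ∎

  iter-*-fixed : ∀ {j x} → iter f j x ≡ x → ∀ q → iter f (q * j) x ≡ x
  iter-*-fixed fix zero    = refl
  iter-*-fixed {j} {x} fix (suc q) = begin
    iter f (j + q * j) x        ≡⟨ iter-+ j (q * j) x ⟩
    iter f j (iter f (q * j) x) ≡⟨ cong (iter f j) (iter-*-fixed fix q) ⟩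
    iter f j x                  ≡⟨ fix ⟩
    x                           ∎

  iter-commuting : (g : A → A) → (∀ v → g (f v) ≡ f (g v)) → ∀ m v → g (iter f m v) ≡ iter f m (g v)
  iter-commuting g gf≡fg zero    v = refl
  iter-commuting g gf≡fg (suc m) v = trans (gf≡fg (iter f m v)) (cong f (iter-commuting g gf≡fg m v))

  iter-injective : Injective _≡_ _≡_ f → ∀ m → Injective _≡_ _≡_ (iter f m)
  iter-injective f-inj zero    eq = eq
  iter-injective f-inj (suc m) eq = iter-injective f-inj m (f-inj eq)

  iter-undo : ∀ {d x} → iter f (suc d) x ≡ x → ∀ m → iter f (d * m) (iter f m x) ≡ x
  iter-undo {d} {x} fix m = begin
    iter f (d * m) (iter f m x) ≡⟨ iter-comm (d * m) m x ⟩
    iter f m (iter f (d * m) x) ≡⟨ iter-+ m (d * m) x ⟨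
    iter f (suc d * m) x        ≡⟨ cong (λ l → iter f l x) (*-comm (suc d) m) ⟩
    iter f (m * suc d) x        ≡⟨ iter-*-fixed fix m ⟩
    x                           ∎

  sameCycle-trans : ∀ {x y z} → SameCycle f x y → SameCycle f y z → SameCycle f x z
  sameCycle-trans {x} (m , refl) (k , refl) = k + m , iter-+ k m x

  sameCycle-sym : ∀ {x y} → Periodic f x → SameCycle f x y → SameCycle f y x
  sameCycle-sym (d , fix) (m , refl) = d * m , iter-undo {d} fix m

  sameCycle-fixed : ∀ {m x y} → iter f m x ≡ x → SameCycle f x y → iter f m y ≡ y
  sameCycle-fixed {m} {x} fix (k , refl) = begin
    iter f m (iter f k x) ≡⟨ iter-comm m k x ⟩
    iter f k (iter f m x) ≡⟨ cong (iter f k) fix ⟩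
    iter f k x            ∎

  cycleLength-minimal : ∀ {x k m} → CycleLength f x k → 0 < m → iter f m x ≡ x → k ≤ m
  cycleLength-minimal (_ , _ , below) 0<m fix = ≮⇒≥ λ m<k → below _ 0<m m<k fix

  cycleLength-commuting-injection : (σ : A → A) → Injective _≡_ _≡_ σ → (∀ v → σ (f v) ≡ f (σ v))
    → ∀ {x k} → CycleLength f x k → CycleLength f (σ x) k
  cycleLength-commuting-injection σ σ-inj σf≡fσ {x} {k} (0<k , fix , below) =
      0<k
    , trans (sym (iter-commuting σ σf≡fσ k x)) (cong σ fix)
    , λ j 0<j j<k fixʲ → below j 0<j j<k (σ-inj (trans (iter-commuting σ σf≡fσ j x) fixʲ))

  module _ (_≟ᴬ_ : DecidableEquality A) where

    cycleLength-from-period : ∀ {x k} → Acc _<_ k → 0 < k → iter f k x ≡ x → ∃ (CycleLength f x)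
    cycleLength-from-period {x} {k} (acc smaller) 0<k fix
      with anyUpTo? (λ j → (0 <? j) ×-dec (iter f j x ≟ᴬ x)) k
    ... | yes (j , j<k , 0<j , fixʲ) = cycleLength-from-period (smaller j<k) 0<j fixʲ
    ... | no none = k , 0<k , fix , λ j 0<j j<k fixʲ → none (j , j<k , 0<j , fixʲ)

    cycleLength-exists : ∀ {x} → Periodic f x → ∃ (CycleLength f x)
    cycleLength-exists (d , fix) = cycleLength-from-period (<-wellFounded (suc d)) z<s fix

injective⇒periodic : ∀ {n} (f : Fin n → Fin n) → Injective _≡_ _≡_ f → ∀ x → Periodic f x
injective⇒periodic {n} f f-inj x
  with i , j , i<j , fⁱ≡fʲ ← pigeonhole (n<1+n n) (λ i → iter f (toℕ i) x)
  with o , i+o≡j ← m≤n⇒∃[o]m+o≡n i<j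
  = o , iter-injective f f-inj (toℕ i) (begin
      iter f (toℕ i) (iter f (suc o) x) ≡⟨ iter-+ f (toℕ i) (suc o) x ⟨
      iter f (toℕ i + suc o) x          ≡⟨ cong (λ l → iter f l x) (+-suc (toℕ i) o) ⟩
      iter f (suc (toℕ i) + o) x        ≡⟨ cong (λ l → iter f l x) i+o≡j ⟩
      iter f (toℕ j) x                  ≡⟨ fⁱ≡fʲ ⟨
      iter f (toℕ i) x                  ∎)

module QuandleTranslations {n : ℕ} {_∙_ : Fin n → Fin n → Fin n} (isQuandle : IsQuandle _∙_) where
  open IsQuandle isQuandle

  _/_ : Fin n → Fin n → Fin n
  i / j = proj₁ (rdiv i j)

  /-∙ : ∀ i j → (i / j) ∙ j ≡ i
  /-∙ i j = proj₁ (proj₂ (rdiv i j))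

  R-injective : ∀ j → Injective _≡_ _≡_ (R _∙_ j)
  R-injective j {u} {v} uj≡vj with _ , _ , only ← rdiv (v ∙ j) j = trans (only u uj≡vj) (sym (only v refl))

  iter-R-∙ : ∀ e m u v → iter (R _∙_ e) m (u ∙ v) ≡ iter (R _∙_ e) m u ∙ iter (R _∙_ e) m v
  iter-R-∙ e zero    u v = refl
  iter-R-∙ e (suc m) u v = trans (cong (_∙ e) (iter-R-∙ e m u v)) (rdistr _ _ e)

  iter-R-self : ∀ e m → iter (R _∙_ e) m e ≡ e
  iter-R-self e zero    = refl
  iter-R-self e (suc m) = trans (cong (_∙ e) (iter-R-self e m)) (idem e)

  L-iter-R : ∀ e m v → e ∙ iter (R _∙_ e) m v ≡ iter (R _∙_ e) m (e ∙ v)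
  L-iter-R e m v = begin
    e ∙ iter (R _∙_ e) m v                  ≡⟨ cong (_∙ iter (R _∙_ e) m v) (iter-R-self e m) ⟨
    iter (R _∙_ e) m e ∙ iter (R _∙_ e) m v ≡⟨ iter-R-∙ e m e v ⟨
    iter (R _∙_ e) m (e ∙ v)                ∎

module _ {n : ℕ} {_∙_ : Fin n → Fin n → Fin n} (isQuandle : IsQuandle _∙_) (o : Fin n)
         (distinct : DistinctCycleLengths (R _∙_ o))
         (uniqueFixedPoint : ∀ i → UniqueFixedPoint (R _∙_ i)) where
  open IsQuandle isQuandle
  open QuandleTranslations isQuandle

  T : Fin n → Fin n
  T = R _∙_ o

  R-fixed⇒≡ : ∀ {y j} → y ∙ j ≡ y → y ≡ j
  R-fixed⇒≡ {y} {j} fix with _ , _ , only ← uniqueFixedPoint j = trans (only y fix) (sym (only j (idem j)))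

  T-periodic : ∀ x → Periodic T x
  T-periodic = injective⇒periodic T (R-injective o)

  T-cycleLength : ∀ x → ∃ (CycleLength T x)
  T-cycleLength x = cycleLength-exists T _≟_ (T-periodic x)

  commuting-injection-stays-in-cycle : (σ : Fin n → Fin n) → Injective _≡_ _≡_ σ
    → (∀ v → σ (T v) ≡ T (σ v)) → ∀ a → SameCycle T a (σ a)
  commuting-injection-stays-in-cycle σ σ-inj σT≡Tσ a with k , clᵃ ← T-cycleLength a =
    distinct a (σ a) k clᵃ (cycleLength-commuting-injection T σ σ-inj σT≡Tσ clᵃ)

  period-transfer : ∀ {a b} → o ∙ a ≡ o ∙ b → ∀ m → iter T m a ≡ a → iter T m b ≡ b
  period-transfer {a} {b} La≡Lb m fixᵃ = R-fixed⇒≡ (begin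
    iter T m b ∙ b          ≡⟨ cong (λ v → iter T m v ∙ b) σu≡b ⟨
    iter T m (σ u) ∙ b      ≡⟨ cong (_∙ b) (iter-commuting T σ σ-T m u) ⟨
    σ (iter T m u) ∙ b      ≡⟨ σ-∙ (iter T m u) ⟩
    iter T m u ∙ a          ≡⟨ cong (iter T m u ∙_) fixᵃ ⟨
    iter T m u ∙ iter T m a ≡⟨ iter-R-∙ o m u a ⟨
    iter T m (u ∙ a)        ≡⟨ cong (iter T m) u∙a≡b ⟩
    iter T m b              ∎)
    where
    σ : Fin n → Fin n
    σ v = (v ∙ a) / b

    σ-∙ : ∀ v → σ v ∙ b ≡ v ∙ a
    σ-∙ v = /-∙ (v ∙ a) b

    σ-T : ∀ v → σ (T v) ≡ T (σ v)
    σ-T v = R-injective b (begin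
      σ (T v) ∙ b         ≡⟨ σ-∙ (T v) ⟩
      (v ∙ o) ∙ a         ≡⟨ rdistr v o a ⟩
      (v ∙ a) ∙ (o ∙ a)   ≡⟨ cong₂ _∙_ (sym (σ-∙ v)) La≡Lb ⟩
      (σ v ∙ b) ∙ (o ∙ b) ≡⟨ rdistr (σ v) o b ⟨
      T (σ v) ∙ b         ∎)

    σ-injective : Injective _≡_ _≡_ σ
    σ-injective {v} {w} σv≡σw = R-injective a (trans (sym (σ-∙ v)) (trans (cong (_∙ b) σv≡σw) (σ-∙ w)))

    t : ℕ
    t = proj₁ (commuting-injection-stays-in-cycle σ σ-injective σ-T a)

    Tᵗa≡σa : iter T t a ≡ σ a
    Tᵗa≡σa = proj₂ (commuting-injection-stays-in-cycle σ σ-injective σ-T a)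

    d : ℕ
    d = proj₁ (T-periodic b)

    -- u = T⁻ᵗ b
    u : Fin n
    u = iter T (d * t) b

    Tᵗu≡b : iter T t u ≡ b
    Tᵗu≡b = trans (iter-comm T t (d * t) b) (iter-undo T {d} (proj₂ (T-periodic b)) t)

    Tᵗ[u∙a]≡σb : iter T t (u ∙ a) ≡ σ b
    Tᵗ[u∙a]≡σb = R-injective b (begin
      iter T t (u ∙ a) ∙ b          ≡⟨ cong (_∙ b) (iter-R-∙ o t u a) ⟩
      (iter T t u ∙ iter T t a) ∙ b ≡⟨ cong₂ (λ p q → (p ∙ q) ∙ b) Tᵗu≡b Tᵗa≡σa ⟩
      (b ∙ σ a) ∙ b                 ≡⟨ rdistr b (σ a) b ⟩
      (b ∙ b) ∙ (σ a ∙ b)           ≡⟨ cong₂ _∙_ (idem b) (trans (σ-∙ a) (idem a)) ⟩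
      b ∙ a                         ≡⟨ σ-∙ b ⟨
      σ b ∙ b                       ∎)

    σu≡u∙a : σ u ≡ u ∙ a
    σu≡u∙a = iter-injective T (R-injective o) t (begin
      iter T t (σ u)   ≡⟨ iter-commuting T σ σ-T t u ⟨
      σ (iter T t u)   ≡⟨ cong σ Tᵗu≡b ⟩
      σ b              ≡⟨ Tᵗ[u∙a]≡σb ⟨
      iter T t (u ∙ a) ∎)

    u∙a≡b : u ∙ a ≡ b
    u∙a≡b = R-fixed⇒≡ (trans (cong (_∙ b) (sym σu≡u∙a)) (σ-∙ u))

    σu≡b : σ u ≡ b
    σu≡b = trans σu≡u∙a u∙a≡b

  L-preimage-in-cycle : ∀ {c} → SameCycle T c (o ∙ c) → ∃ λ y → SameCycle T c y × o ∙ y ≡ c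
  L-preimage-in-cycle {c} c~Lc with r , back ← sameCycle-sym T (T-periodic c) c~Lc =
    iter T r c , (r , refl) , trans (L-iter-R o r c) back

  L-stays-in-cycle-of-length : ∀ {k} → Acc _<_ k → ∀ x → CycleLength T x k → SameCycle T x (o ∙ x)
  L-stays-in-cycle-of-length {k} (acc shorter) x clˣ@(0<k , fixˣ , belowˣ)
    with j , clᶜ@(0<j , fixᶜ , _) ← T-cycleLength (o ∙ x)
    with m≤n⇒m<n∨m≡n (cycleLength-minimal T clᶜ 0<k (trans (sym (L-iter-R o k x)) (cong (o ∙_) fixˣ)))
  ... | inj₂ refl = distinct x (o ∙ x) k clˣ clᶜ
  ... | inj₁ j<k
    with y , c~y , Ly≡c ← L-preimage-in-cycle (L-stays-in-cycle-of-length (shorter j<k) (o ∙ x) clᶜ)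
    = ⊥-elim (belowˣ j 0<j j<k (period-transfer Ly≡c j (sameCycle-fixed T {j} fixᶜ c~y)))

  L-stays-in-cycle : ∀ x → SameCycle T x (o ∙ x)
  L-stays-in-cycle x with k , clˣ ← T-cycleLength x = L-stays-in-cycle-of-length (<-wellFounded k) x clˣ

  L-injective : Injective _≡_ _≡_ (L _∙_ o)
  L-injective {a} {b} La≡Lb
    with s , Tˢa≡La ← L-stays-in-cycle a
    with m , refl ← sameCycle-trans T (L-stays-in-cycle a)
                      (subst (λ v → SameCycle T v b) (sym La≡Lb) (sameCycle-sym T (T-periodic b) (L-stays-in-cycle b)))
    = iter-injective T (R-injective o) s (begin
      iter T s a              ≡⟨ Tˢa≡La ⟩
      o ∙ a                   ≡⟨ La≡Lb ⟩
      o ∙ iter T m a          ≡⟨ L-iter-R o m a ⟩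
      iter T m (o ∙ a)        ≡⟨ cong (iter T m) Tˢa≡La ⟨
      iter T m (iter T s a)   ≡⟨ iter-comm T m s a ⟩
      iter T s (iter T m a)   ∎)

  L-surjective : ∀ y → ∃ λ x → o ∙ x ≡ y
  L-surjective y = map₂ proj₂ (L-preimage-in-cycle (L-stays-in-cycle y))

  L-orbit-in-R-cycle : ∀ m x → SameCycle T x (iter (L _∙_ o) m x)
  L-orbit-in-R-cycle zero    x = 0 , refl
  L-orbit-in-R-cycle (suc m) x = sameCycle-trans T (L-orbit-in-R-cycle m x) (L-stays-in-cycle (iter (L _∙_ o) m x))

proposition3p3 : (n : ℕ) (_∙_ : Fin n → Fin n → Fin n) → IsQuandle _∙_ → (e : Fin n)
    → DistinctCycleLengths (R _∙_ e)
    → (∀ i → UniqueFixedPoint (R _∙_ i))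
    → Bijective {A = Fin n} {B = Fin n} _≡_ _≡_ (L _∙_ e)
      × (∀ x y → SameCycle (L _∙_ e) x y → SameCycle (R _∙_ e) x y)
proposition3p3 n _∙_ isQuandle e distinct unique =
    (L-injective isQuandle e distinct unique
    , strictlySurjective⇒surjective (L-surjective isQuandle e distinct unique))
  , λ { x _ (m , refl) → L-orbit-in-R-cycle isQuandle e distinct unique m x }
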